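{- Let $R$ be a full, complete, rooted binary tree with $n$ leaves, and $T$ a full rooted binary tree with $n$ leaves, the leaves of both trees being $1,2,\dots,n$ read from left to right. Let $p,s$ be two distinct nodes of $T$ and $a,b$ two nodes of $R$ with $a\in X_{I_T(p)}$ and $b\in X_{I_T(s)}$. If $a\preceq_R b$, then $p\preceq_T s$ or $s\preceq_T p$. Furthermore, if $a\prec_R b$, then $p\prec_T s$.
   Context: A rooted binary tree is full if every non-leaf node has exactly two children, and complete if all its levels are completely filled except possibly the last one, in which the leaves are left-aligned. In a rooted tree $Q$, $x\preceq_Q y$ means $x$ is an ancestor of $y$ (possibly $x=y$), and $x\prec_Q y$ means $x\preceq_Q y$ and $x\neq y$. For a node $x$ of $T$ (resp. $R$), $I_T(x)$ (resp. $I_R(x)$) denotes the set of leaves of the subtree rooted at $x$; it is an interval of $[n]$. For an interval $I\subseteq[n]$, $X_I$ denotes the (unique) minimum-cardinality set $X$ of nodes of $R$ such that the sets $I_R(x)$, $x\in X$, partition $I$. -}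

module Defs where

open import Data.Nat using (ℕ; zero; suc; _+_; _*_; _^_; _≤_; _<_; _⊔_)
open import Data.Product using (Σ; ∃; _×_; _,_)
open import Data.Sum using (_⊎_)
open import Data.List using (List; length)
open import Data.List.Membership.Propositional using (_∈_)
open import Data.List.Relation.Unary.Unique.Propositional using (Unique)
open import Relation.Binary.PropositionalEquality using (_≡_; _≢_)
open import Relation.Nullary using (¬_)

-- Rooted binary trees in which every internal node has exactly two
-- children (i.e. FULL rooted binary trees; every value of this type is full).
-- The leaves are implicitly numbered 1,2,...,n from left to right.
data Tree : Set where
  leaf : Tree
  node : Tree → Tree → Tree

leaves : Tree → ℕ
leaves leaf       = 1
leaves (node l r) = leaves l + leaves r

height : Tree → ℕ
height leaf       = 0
height (node l r) = suc (height l ⊔ height r)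

-- nodes of a tree, given by their path from the root
data Pos : Tree → Set where
  here : ∀ {t} → Pos t
  goL  : ∀ {l r} → Pos l → Pos (node l r)
  goR  : ∀ {l r} → Pos r → Pos (node l r)

depth : ∀ {t} → Pos t → ℕ
depth here    = 0
depth (goL p) = suc (depth p)
depth (goR p) = suc (depth p)

-- left-to-right index of a node within its level (0-based):
-- the path read as a binary number, left = 0, right = 1, most significant first
levelIndex : ∀ {t} → Pos t → ℕ
levelIndex here    = 0
levelIndex (goL p) = levelIndex p
levelIndex (goR p) = 2 ^ depth p + levelIndex p

-- complete: all levels except possibly the last are completely filled,
-- and the nodes of the last level are left-aligned
Complete : Tree → Set
Complete t =
  (∀ k → k < height t → ∀ j → j < 2 ^ k →
     Σ (Pos t) λ q → depth q ≡ k × levelIndex q ≡ j)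
  × (∀ (p : Pos t) → depth p ≡ height t → ∀ j → j ≤ levelIndex p →
     Σ (Pos t) λ q → depth q ≡ height t × levelIndex q ≡ j)

-- ancestor relation x ⪯ y (x is an ancestor of y, possibly x = y)
data _⪯_ : ∀ {t} → Pos t → Pos t → Set where
  here⪯ : ∀ {t} {y : Pos t} → here ⪯ y
  goL⪯  : ∀ {l r} {x y : Pos l} → x ⪯ y → goL {l} {r} x ⪯ goL y
  goR⪯  : ∀ {l r} {x y : Pos r} → x ⪯ y → goR {l} {r} x ⪯ goR y

_≺_ : ∀ {t} → Pos t → Pos t → Set
x ≺ y = x ⪯ y × x ≢ y

-- I_t(x) = [first t x , last t x] : the leaves (numbered 1..n) below x
first : (t : Tree) → Pos t → ℕ
first t          here    = 1
first (node l r) (goL p) = first l p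
first (node l r) (goR p) = leaves l + first r p

last : (t : Tree) → Pos t → ℕ
last t          here    = leaves t
last (node l r) (goL p) = last l p
last (node l r) (goR p) = leaves l + last r p

InI : (t : Tree) → Pos t → ℕ → Set
InI t x i = first t x ≤ i × i ≤ last t x

Partitions : (R : Tree) → ℕ → ℕ → List (Pos R) → Set
Partitions R lo hi X =
  Unique X
  × (∀ {x} → x ∈ X → ∀ i → InI R x i → lo ≤ i × i ≤ hi)
  × (∀ i → lo ≤ i → i ≤ hi → Σ (Pos R) λ x → x ∈ X × InI R x i)
  × (∀ {x y} → x ∈ X → y ∈ X → x ≢ y → ∀ i → ¬ (InI R x i × InI R y i))

-- X is a minimum-cardinality such set (i.e. X = X_[lo,hi])
IsX : (R : Tree) → ℕ → ℕ → List (Pos R) → Set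
IsX R lo hi X =
  Partitions R lo hi X × (∀ Y → Partitions R lo hi Y → length X ≤ length Y)

InX : (R : Tree) → ℕ → ℕ → Pos R → Set
InX R lo hi a = Σ (List (Pos R)) λ X → IsX R lo hi X × a ∈ X

module Submission where

open import Defs
open import Data.Nat using (ℕ; _+_; _≤_; _<_; _∸_; s≤s)
open import Data.Nat.Properties
open import Data.Product using (_×_; _,_; Σ; proj₁; proj₂)
open import Data.Sum using (_⊎_; inj₁; inj₂)
open import Data.Empty using (⊥-elim)
open import Data.List using (List; _∷_; length; filter)
open import Data.List.Properties using (filter-notAll)
open import Data.List.Relation.Unary.Any using (here; there)
import Data.List.Relation.Unary.Any as Any
import Data.List.Relation.Unary.All as All
open import Data.List.Relation.Unary.AllPairs using (_∷_)
open import Data.List.Membership.Propositional using (_∈_)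
open import Data.List.Membership.Propositional.Properties using (∈-filter⁺; ∈-filter⁻)
open import Data.List.Relation.Unary.Unique.Propositional using (Unique)
open import Data.List.Relation.Unary.Unique.Propositional.Properties using (filter⁺)
open import Relation.Nullary using (¬_; Dec; yes; no; ¬?)
open import Relation.Unary using (Pred; Decidable)
open import Relation.Binary.PropositionalEquality using (_≡_; _≢_; refl; cong; subst; sym)

-- The intervals I(x) of the nodes of a tree form a laminar family: two of
-- them meet only if one node is an ancestor of the other.  Since I_R(a) ⊆ I_T(p)
-- and I_R(b) ⊆ I_T(s) share a leaf, p and s are comparable.  If a ≺ b but
-- s ⪯ p, then I_R(a) ⊆ I_T(s); replacing by a all members of X_{I_T(s)} below
-- a still partitions I_T(s), and removes at least two nodes (b, and one covering
-- a leaf of I_R(a) outside I_R(b)) while adding one, contradicting minimality.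

1≤leaves : ∀ t → 1 ≤ leaves t
1≤leaves leaf       = ≤-refl
1≤leaves (node l r) = ≤-trans (1≤leaves l) (m≤m+n (leaves l) (leaves r))

1≤first : ∀ t (x : Pos t) → 1 ≤ first t x
1≤first t          here    = ≤-refl
1≤first (node l r) (goL x) = 1≤first l x
1≤first (node l r) (goR x) = ≤-trans (1≤first r x) (m≤n+m (first r x) (leaves l))

last≤leaves : ∀ t (x : Pos t) → last t x ≤ leaves t
last≤leaves t          here    = ≤-refl
last≤leaves (node l r) (goL x) = ≤-trans (last≤leaves l x) (m≤m+n (leaves l) (leaves r))
last≤leaves (node l r) (goR x) = +-monoʳ-≤ (leaves l) (last≤leaves r x)

first≤last : ∀ t (x : Pos t) → first t x ≤ last t x
first≤last t          here    = 1≤leaves t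
first≤last (node l r) (goL x) = first≤last l x
first≤last (node l r) (goR x) = +-monoʳ-≤ (leaves l) (first≤last r x)

first∈I : ∀ t (x : Pos t) → InI t x (first t x)
first∈I t x = ≤-refl , first≤last t x

⪯-refl : ∀ {t} (x : Pos t) → x ⪯ x
⪯-refl here    = here⪯
⪯-refl (goL x) = goL⪯ (⪯-refl x)
⪯-refl (goR x) = goR⪯ (⪯-refl x)

⪯-trans : ∀ {t} {x y z : Pos t} → x ⪯ y → y ⪯ z → x ⪯ z
⪯-trans here⪯     _         = here⪯
⪯-trans (goL⪯ p) (goL⪯ q) = goL⪯ (⪯-trans p q)
⪯-trans (goR⪯ p) (goR⪯ q) = goR⪯ (⪯-trans p q)

⪯-antisym : ∀ {t} {x y : Pos t} → x ⪯ y → y ⪯ x → x ≡ y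
⪯-antisym here⪯     here⪯     = refl
⪯-antisym (goL⪯ p) (goL⪯ q) = cong goL (⪯-antisym p q)
⪯-antisym (goR⪯ p) (goR⪯ q) = cong goR (⪯-antisym p q)

_⪯?_ : ∀ {t} (x y : Pos t) → Dec (x ⪯ y)
here  ⪯? y = yes here⪯
goL x ⪯? here = no λ ()
goL x ⪯? goR y = no λ ()
goR x ⪯? here = no λ ()
goR x ⪯? goL y = no λ ()
goL x ⪯? goL y with x ⪯? y
... | yes x⪯y = yes (goL⪯ x⪯y)
... | no  x⋠y = no λ { (goL⪯ x⪯y) → x⋠y x⪯y }
goR x ⪯? goR y with x ⪯? y
... | yes x⪯y = yes (goR⪯ x⪯y)
... | no  x⋠y = no λ { (goR⪯ x⪯y) → x⋠y x⪯y }

⪯⇒interval⊇ : ∀ {t} {x y : Pos t} → x ⪯ y → first t x ≤ first t y × last t y ≤ last t x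
⪯⇒interval⊇ {t} {y = y} here⪯ = 1≤first t y , last≤leaves t y
⪯⇒interval⊇ (goL⪯ x⪯y) = ⪯⇒interval⊇ x⪯y
⪯⇒interval⊇ {node l r} (goR⪯ x⪯y) with ⪯⇒interval⊇ x⪯y
... | f≤f , l≤l = +-monoʳ-≤ (leaves l) f≤f , +-monoʳ-≤ (leaves l) l≤l

⪯⇒InI : ∀ {t} {x y : Pos t} {i} → x ⪯ y → InI t y i → InI t x i
⪯⇒InI x⪯y (f≤i , i≤l) with ⪯⇒interval⊇ x⪯y
... | f≤f , l≤l = ≤-trans f≤f f≤i , ≤-trans i≤l l≤l

≺⇒interval⊃ : ∀ {t} {x y : Pos t} → x ⪯ y → x ≢ y →
  first t x < first t y ⊎ last t y < last t x
≺⇒interval⊃ {y = here} here⪯ x≢y = ⊥-elim (x≢y refl)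
≺⇒interval⊃ {node l r} {y = goL y} here⪯ _ =
  inj₂ (≤-<-trans (last≤leaves l y) (m<m+n (leaves l) (1≤leaves r)))
≺⇒interval⊃ {node l r} {y = goR y} here⪯ _ = inj₁ (+-mono-≤ (1≤leaves l) (1≤first r y))
≺⇒interval⊃ (goL⪯ x⪯y) x≢y = ≺⇒interval⊃ x⪯y (λ x≡y → x≢y (cong goL x≡y))
≺⇒interval⊃ {node l r} (goR⪯ x⪯y) x≢y with ≺⇒interval⊃ x⪯y (λ x≡y → x≢y (cong goR x≡y))
... | inj₁ f<f = inj₁ (+-monoʳ-< (leaves l) f<f)
... | inj₂ l<l = inj₂ (+-monoʳ-< (leaves l) l<l)

≺⇒leaf-outside : ∀ {t} {x y : Pos t} → x ≺ y → Σ ℕ λ i → InI t x i × ¬ InI t y i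
≺⇒leaf-outside {t} {x} (x⪯y , x≢y) with ≺⇒interval⊃ x⪯y x≢y
... | inj₁ f<f = first t x , first∈I t x , λ (f≤i , _) → <⇒≱ f<f f≤i
... | inj₂ l<l = last t x , (first≤last t x , ≤-refl) , λ (_ , i≤l) → <⇒≱ l<l i≤l

InI-goR⁻ : ∀ {l r} {x : Pos r} {i} → InI (node l r) (goR x) i → InI r x (i ∸ leaves l)
InI-goR⁻ {l} {r} {x} (f≤i , i≤l) =
  ≤-trans (≤-reflexive (sym (m+n∸m≡n (leaves l) (first r x)))) (∸-monoˡ-≤ (leaves l) f≤i) ,
  ≤-trans (∸-monoˡ-≤ (leaves l) i≤l) (≤-reflexive (m+n∸m≡n (leaves l) (last r x)))

InI-goL-goR-disjoint : ∀ {l r} {x : Pos l} {y : Pos r} {i} →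
  ¬ (InI (node l r) (goL x) i × InI (node l r) (goR y) i)
InI-goL-goR-disjoint {l} {r} {x} {y} ((_ , i≤last) , (first≤i , _)) =
  <⇒≱ (≤-<-trans (last≤leaves l x) (m<m+n (leaves l) (1≤first r y)))
      (≤-trans first≤i i≤last)

laminar : ∀ {t} (x y : Pos t) {i} → InI t x i → InI t y i → x ⪯ y ⊎ y ⪯ x
laminar here    _       _ _ = inj₁ here⪯
laminar (goL _) here    _ _ = inj₂ here⪯
laminar (goR _) here    _ _ = inj₂ here⪯
laminar (goL x) (goR y) x∋i y∋i = ⊥-elim (InI-goL-goR-disjoint {x = x} {y} (x∋i , y∋i))
laminar (goR x) (goL y) x∋i y∋i = ⊥-elim (InI-goL-goR-disjoint {x = y} {x} (y∋i , x∋i))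
laminar (goL x) (goL y) x∋i y∋i with laminar x y x∋i y∋i
... | inj₁ x⪯y = inj₁ (goL⪯ x⪯y)
... | inj₂ y⪯x = inj₂ (goL⪯ y⪯x)
laminar {node l _} (goR x) (goR y) x∋i y∋i
  with laminar x y (InI-goR⁻ {l} {x = x} x∋i) (InI-goR⁻ {l} {x = y} y∋i)
... | inj₁ x⪯y = inj₁ (goR⪯ x⪯y)
... | inj₂ y⪯x = inj₂ (goR⪯ y⪯x)

⪯-≺-trans : ∀ {t} {x y z : Pos t} → x ⪯ y → y ≺ z → x ≺ z
⪯-≺-trans x⪯y (y⪯z , y≢z) =
  ⪯-trans x⪯y y⪯z , λ { refl → y≢z (⪯-antisym y⪯z x⪯y) }

module _ {A : Set} {p} {P : Pred A p} (P? : Decidable P) where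

  length-filter-drop₂ : ∀ {x z} (xs : List A) → x ∈ xs → z ∈ xs → x ≢ z → ¬ P x → ¬ P z →
    2 + length (filter P? xs) ≤ length xs
  length-filter-drop₂ (y ∷ ys) (here refl) (here refl) x≢z _ _ = ⊥-elim (x≢z refl)
  length-filter-drop₂ (y ∷ ys) (here refl) (there z∈ys) _ ¬Py ¬Pz with P? y
  ... | yes Py = ⊥-elim (¬Py Py)
  ... | no  _  = s≤s (filter-notAll P? ys (Any.map (λ { refl → ¬Pz }) z∈ys))
  length-filter-drop₂ (y ∷ ys) (there x∈ys) (here refl) _ ¬Px ¬Py with P? y
  ... | yes Py = ⊥-elim (¬Py Py)
  ... | no  _  = s≤s (filter-notAll P? ys (Any.map (λ { refl → ¬Px }) x∈ys))
  length-filter-drop₂ (y ∷ ys) (there x∈ys) (there z∈ys) x≢z ¬Px ¬Pz with P? y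
  ... | yes _ = s≤s (length-filter-drop₂ ys x∈ys z∈ys x≢z ¬Px ¬Pz)
  ... | no  _ = m≤n⇒m≤1+n (length-filter-drop₂ ys x∈ys z∈ys x≢z ¬Px ¬Pz)

Within : (t : Tree) → Pos t → ℕ → ℕ → Set
Within t x lo hi = ∀ i → InI t x i → lo ≤ i × i ≤ hi

Within-widen : ∀ {t x lo hi lo′ hi′} → lo′ ≤ lo → hi ≤ hi′ → Within t x lo hi → Within t x lo′ hi′
Within-widen lo′≤lo hi≤hi′ x⊆I i x∋i with x⊆I i x∋i
... | lo≤i , i≤hi = ≤-trans lo′≤lo lo≤i , ≤-trans i≤hi hi≤hi′

InX⇒Within : ∀ {R lo hi a} → InX R lo hi a → Within R a lo hi
InX⇒Within (_ , ((_ , ⊆I , _) , _) , a∈X) = ⊆I a∈X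

partition-no-≺ : ∀ {R lo hi X} {b c : Pos R} → Partitions R lo hi X → c ∈ X → b ∈ X → ¬ c ≺ b
partition-no-≺ {R} {b = b} (_ , _ , _ , disjoint) c∈X b∈X (c⪯b , c≢b) =
  disjoint c∈X b∈X c≢b (first R b) (⪯⇒InI c⪯b (first∈I R b) , first∈I R b)

coarsen : ∀ {t} → Pos t → List (Pos t) → List (Pos t)
coarsen a X = a ∷ filter (λ x → ¬? (a ⪯? x)) X

module Coarsening {R : Tree} {lo hi : ℕ} {X : List (Pos R)} (PX : Partitions R lo hi X)
                  {a : Pos R} (a⊆I : Within R a lo hi) (no-ancestor : ∀ {c} → c ∈ X → ¬ c ⪯ a)
                  where

  private
    a⋠? : Decidable (λ x → ¬ a ⪯ x)
    a⋠? x = ¬? (a ⪯? x)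

    covers : ∀ i → lo ≤ i → i ≤ hi → Σ (Pos R) λ x → x ∈ X × InI R x i
    covers = proj₁ (proj₂ (proj₂ PX))

  kept⁻ : ∀ {x} → x ∈ filter a⋠? X → x ∈ X × ¬ a ⪯ x
  kept⁻ = ∈-filter⁻ a⋠? {xs = X}

  kept-disjoint-a : ∀ {x i} → x ∈ filter a⋠? X → ¬ (InI R a i × InI R x i)
  kept-disjoint-a {x} x∈F (a∋i , x∋i) with kept⁻ x∈F
  ... | x∈X , a⋠x with laminar a x a∋i x∋i
  ...   | inj₁ a⪯x = a⋠x a⪯x
  ...   | inj₂ x⪯a = no-ancestor x∈X x⪯a

  coarsen-Partitions : Partitions R lo hi (coarsen a X)
  coarsen-Partitions = unique′ , ⊆I′ , covers′ , disjoint′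
    where
    unique′ : Unique (coarsen a X)
    unique′ = All.tabulate (λ x∈F a≡x → proj₂ (kept⁻ x∈F) (subst (a ⪯_) a≡x (⪯-refl a)))
              ∷ filter⁺ a⋠? {xs = X} (proj₁ PX)

    ⊆I′ : ∀ {x} → x ∈ coarsen a X → Within R x lo hi
    ⊆I′ (here refl) = a⊆I
    ⊆I′ (there x∈F) = proj₁ (proj₂ PX) (proj₁ (kept⁻ x∈F))

    covers′ : ∀ i → lo ≤ i → i ≤ hi → Σ (Pos R) λ x → x ∈ coarsen a X × InI R x i
    covers′ i lo≤i i≤hi with covers i lo≤i i≤hi
    ... | x , x∈X , x∋i with a ⪯? x
    ...   | yes a⪯x = a , here refl , ⪯⇒InI a⪯x x∋i
    ...   | no  a⋠x = x , there (∈-filter⁺ a⋠? x∈X a⋠x) , x∋i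

    disjoint′ : ∀ {x y} → x ∈ coarsen a X → y ∈ coarsen a X → x ≢ y →
      ∀ i → ¬ (InI R x i × InI R y i)
    disjoint′ (here refl) (here refl) x≢y _ _ = x≢y refl
    disjoint′ (here refl) (there y∈F) _ _ (a∋i , y∋i) = kept-disjoint-a y∈F (a∋i , y∋i)
    disjoint′ (there x∈F) (here refl) _ _ (x∋i , a∋i) = kept-disjoint-a x∈F (a∋i , x∋i)
    disjoint′ (there x∈F) (there y∈F) = proj₂ (proj₂ (proj₂ PX)) (proj₁ (kept⁻ x∈F)) (proj₁ (kept⁻ y∈F))

  -- Besides b, the member of X covering a leaf of I(a) outside I(b) lies below a.
  coarsen-shorter : ∀ {b} → b ∈ X → a ≺ b → length (coarsen a X) < length X
  coarsen-shorter {b} b∈X a≺b@(a⪯b , _) with ≺⇒leaf-outside a≺b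
  ... | i , a∋i , b∌i with a⊆I i a∋i
  ...   | lo≤i , i≤hi with covers i lo≤i i≤hi
  ...     | c , c∈X , c∋i with laminar a c a∋i c∋i
  ...       | inj₂ c⪯a = ⊥-elim (no-ancestor c∈X c⪯a)
  ...       | inj₁ a⪯c =
    length-filter-drop₂ a⋠? X b∈X c∈X (λ { refl → b∌i c∋i }) (λ a⋠b → a⋠b a⪯b) (λ a⋠c → a⋠c a⪯c)

InX-maximal : ∀ {R lo hi} {a b : Pos R} → InX R lo hi b → a ≺ b → ¬ Within R a lo hi
InX-maximal (X , (PX , minimum) , b∈X) a≺b a⊆I =
  <⇒≱ (coarsen-shorter b∈X a≺b) (minimum _ coarsen-Partitions)
  where
  open Coarsening PX a⊆I (λ c∈X c⪯a → partition-no-≺ PX c∈X b∈X (⪯-≺-trans c⪯a a≺b))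

lemma4p4 : (n : ℕ) (R T : Tree) → Complete R → leaves R ≡ n → leaves T ≡ n →
    (p s : Pos T) → p ≢ s → (a b : Pos R) →
    InX R (first T p) (last T p) a → InX R (first T s) (last T s) b →
    a ⪯ b → (p ⪯ s ⊎ s ⪯ p) × (a ≺ b → p ≺ s)
lemma4p4 _ R T _ _ _ p s p≢s a b a∈Xp b∈Xs a⪯b = comparable , strict
  where
  a⊆Ip = InX⇒Within a∈Xp
  b∋i = first∈I R b

  comparable : p ⪯ s ⊎ s ⪯ p
  comparable = laminar p s (a⊆Ip _ (⪯⇒InI a⪯b b∋i)) (InX⇒Within b∈Xs _ b∋i)

  strict : a ≺ b → p ≺ s
  strict a≺b with comparable
  ... | inj₁ p⪯s = p⪯s , p≢s
  ... | inj₂ s⪯p = ⊥-elim (InX-maximal b∈Xs a≺b (Within-widen {x = a} s≤p p≤s a⊆Ip))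
    where
    s≤p = proj₁ (⪯⇒interval⊇ s⪯p)
    p≤s = proj₂ (⪯⇒interval⊇ s⪯p)
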